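{- Let $G$ be a finite simple bipartite graph with bipartition $\{x_1,\dots,x_m\}$, $\{y_1,\dots,y_n\}$, where $m,n\ge 1$. If $G$ is shellable and $G$ has no isolated vertices, then there is a vertex $v$ of $G$ with $\deg(v)=1$.
   Context: For a graph $G$, $\Delta_G$ is the simplicial complex on the vertex set whose faces are the independent sets of $G$. A simplicial complex is shellable if its facets can be ordered $F_1,\dots,F_s$ so that for all $1\le i<j\le s$ there exist $v\in F_j\setminus F_i$ and $\ell\in\{1,\dots,j-1\}$ with $F_j\setminus F_\ell=\{v\}$ (non-pure shellability). $G$ is shellable if $\Delta_G$ is. -}

module Defs where

open import Data.Nat using (ℕ)
open import Data.Fin using (Fin; _<_)
open import Data.Bool using (Bool; true; false; T)
open import Data.Sum using (_⊎_; inj₁; inj₂)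
open import Data.Product using (Σ; ∃; _×_; _,_)
open import Data.List using (List; length; filter; allFin)
open import Relation.Binary.PropositionalEquality using (_≡_)
open import Relation.Nullary using (¬_)
open import Relation.Unary using (Decidable)
open import Data.Bool.Properties using (T?)
open import Function.Bundles using (_⇔_)

-- A finite simple bipartite graph with parts {x_1..x_m} (inj₁) and
-- {y_1..y_n} (inj₂), given by its (Boolean) biadjacency relation.
-- Simplicity is automatic: no loops, no multi-edges, undirected.
record BipGraph (m n : ℕ) : Set where
  field
    E : Fin m → Fin n → Bool

Vertex : ℕ → ℕ → Set
Vertex m n = Fin m ⊎ Fin n

adj : ∀ {m n} → BipGraph m n → Vertex m n → Vertex m n → Bool
adj G (inj₁ i) (inj₂ j) = BipGraph.E G i j
adj G (inj₂ j) (inj₁ i) = BipGraph.E G i j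
adj G (inj₁ _) (inj₁ _) = false
adj G (inj₂ _) (inj₂ _) = false

deg : ∀ {m n} → BipGraph m n → Vertex m n → ℕ
deg {m} {n} G (inj₁ i) = length (filter (λ j → T? (BipGraph.E G i j)) (allFin n))
deg {m} {n} G (inj₂ j) = length (filter (λ i → T? (BipGraph.E G i j)) (allFin m))

VSet : ℕ → ℕ → Set
VSet m n = Vertex m n → Bool

_∈ₛ_ : ∀ {m n} → Vertex m n → VSet m n → Set
v ∈ₛ S = T (S v)

_⊆ₛ_ : ∀ {m n} → VSet m n → VSet m n → Set
S ⊆ₛ S' = ∀ v → v ∈ₛ S → v ∈ₛ S'

_≐_ : ∀ {m n} → VSet m n → VSet m n → Set
S ≐ S' = ∀ v → S v ≡ S' v

-- faces of Δ_G: independent sets of G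
Independent : ∀ {m n} → BipGraph m n → VSet m n → Set
Independent G S = ∀ u v → u ∈ₛ S → v ∈ₛ S → adj G u v ≡ false

IsFacet : ∀ {m n} → BipGraph m n → VSet m n → Set
IsFacet G S = Independent G S × (∀ S' → Independent G S' → S ⊆ₛ S' → S' ⊆ₛ S)

record Shelling {m n} (G : BipGraph m n) : Set where
  field
    s        : ℕ
    F        : Fin s → VSet m n
    facet    : ∀ i → IsFacet G (F i)
    complete : ∀ S → IsFacet G S → ∃ λ i → F i ≐ S
    distinct : ∀ i j → F i ≐ F j → i ≡ j
    shell    : ∀ i j → i < j →
               Σ (Vertex m n) λ v → (v ∈ₛ F j) × ¬ (v ∈ₛ F i) ×
               (Σ (Fin s) λ ℓ → ℓ < j ×
                  (∀ w → ((w ∈ₛ F j) × ¬ (w ∈ₛ F ℓ)) ⇔ (w ≡ v)))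

Shellable : ∀ {m n} → BipGraph m n → Set
Shellable G = Shelling G

NoIsolated : ∀ {m n} → BipGraph m n → Set
NoIsolated G = ∀ v → ¬ (deg G v ≡ 0)

{-# OPTIONS --safe #-}

-- Both bipartition classes X and Y are facets of Δ_G (they are independent vertex covers and G has
-- no isolated vertices), so in a shelling one of them, say P, comes after the other.  The shelling
-- condition yields an earlier facet Q with P ∖ Q = {v}.  Q ⊄ P, for otherwise maximality of Q
-- would force P ⊆ Q; pick u ∈ Q ∖ P.  Every neighbour w of u lies in the cover P but not in the
-- independent set Q, so w = v: the non-isolated vertex u has degree exactly 1.
module Submission where

open import Defs
open import Data.Bool using (true; false; T)
open import Data.Bool.Properties using (T?; T-≡)
open import Data.Fin using (Fin; zero; _<_)
open import Data.Fin.Properties using (<-cmp; any?)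
open import Data.List using (List; []; _∷_; length; filter; allFin)
open import Data.List.Membership.Propositional using (_∈_)
open import Data.List.Membership.Propositional.Properties using (∈-allFin; ∈-filter⁺)
open import Data.List.Relation.Unary.All as All using (All; _∷_)
open import Data.List.Relation.Unary.All.Properties using (all-filter)
open import Data.List.Relation.Unary.AllPairs using (_∷_)
open import Data.List.Relation.Unary.Unique.Propositional using (Unique)
open import Data.List.Relation.Unary.Unique.Propositional.Properties using (allFin⁺; filter⁺)
open import Data.Nat using (ℕ; suc; _≥_)
open import Data.Product using (Σ; ∃; ∃₂; _×_; _,_; proj₁; proj₂)
open import Data.Sum using (_⊎_; inj₁; inj₂)
open import Data.Sum.Properties using (inj₂-injective; inj₁-injective)
open import Function using (_∘_)
open import Function.Bundles using (Equivalence; _⇔_)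
open import Relation.Binary using (tri<; tri≈; tri>)
open import Relation.Binary.PropositionalEquality using (_≡_; _≢_; refl; sym; trans; subst)
open import Relation.Nullary using (Dec; yes; no; ¬_; ¬?; contradiction)
open import Relation.Nullary.Decidable using (_×-dec_)
open import Relation.Unary using (Pred; Decidable)

open Equivalence using (to; from)

filter-nonempty⇒∃ : ∀ {a p} {A : Set a} {P : Pred A p} (P? : Decidable P) xs →
                    length (filter P? xs) ≢ 0 → ∃ P
filter-nonempty⇒∃ P? xs ≢0 with filter P? xs | all-filter P? xs
... | []    | _      = contradiction refl ≢0
... | x ∷ _ | Px ∷ _ = x , Px

length≡1 : ∀ {a} {A : Set a} {xs : List A} {b : A} →
           Unique xs → All (_≡ b) xs → b ∈ xs → length xs ≡ 1
length≡1 {xs = _ ∷ []}    _               _                 _ = refl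
length≡1 {xs = _ ∷ _ ∷ _} ((x≢y ∷ _) ∷ _) (refl ∷ refl ∷ _) _ = contradiction refl x≢y

length-filter-allFin≡1 : ∀ {n p} {P : Pred (Fin n) p} (P? : Decidable P) {b : Fin n} →
                         P b → (∀ j → P j → j ≡ b) → length (filter P? (allFin n)) ≡ 1
length-filter-allFin≡1 {n} P? Pb only =
  length≡1 (filter⁺ P? (allFin⁺ n))
           (All.map (only _) (all-filter P? (allFin n)))
           (∈-filter⁺ P? (∈-allFin _) Pb)

vertex-any? : ∀ {m n p} {P : Pred (Vertex m n) p} → Decidable P → Dec (∃ P)
vertex-any? P? with any? (P? ∘ inj₁) | any? (P? ∘ inj₂)
... | yes (i , Pi) | _            = yes (inj₁ i , Pi)
... | no _         | yes (j , Pj) = yes (inj₂ j , Pj)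
... | no ∄i        | no ∄j        = no λ { (inj₁ i , Pi) → ∄i (i , Pi)
                                         ; (inj₂ j , Pj) → ∄j (j , Pj) }

module _ {m n : ℕ} (G : BipGraph m n) where
  open BipGraph G

  VertexCover : VSet m n → Set
  VertexCover S = ∀ u w → adj G u w ≡ true → u ∈ₛ S ⊎ w ∈ₛ S

  AdjacentOnlyTo : Vertex m n → Vertex m n → Set
  AdjacentOnlyTo u v = ∀ w → adj G u w ≡ true → w ≡ v

  adjacent⇒¬both-in-independent : ∀ {S u w} → Independent G S → adj G u w ≡ true →
                                  u ∈ₛ S → ¬ w ∈ₛ S
  adjacent⇒¬both-in-independent indS uw u∈S w∈S with () ← trans (sym uw) (indS _ _ u∈S w∈S)

  deg≢0⇒neighbour : ∀ u → deg G u ≢ 0 → ∃ λ w → adj G u w ≡ true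
  deg≢0⇒neighbour (inj₁ i) d with filter-nonempty⇒∃ (λ j → T? (E i j)) (allFin n) d
  ... | j , Eij = inj₂ j , to T-≡ Eij
  deg≢0⇒neighbour (inj₂ j) d with filter-nonempty⇒∃ (λ i → T? (E i j)) (allFin m) d
  ... | i , Eij = inj₁ i , to T-≡ Eij

  unique-neighbour⇒deg≡1 : ∀ {u v} → adj G u v ≡ true → AdjacentOnlyTo u v → deg G u ≡ 1
  unique-neighbour⇒deg≡1 {inj₁ i} {inj₂ _} uv only =
    length-filter-allFin≡1 (λ j → T? (E i j)) (from T-≡ uv)
      (λ j Eij → inj₂-injective (only (inj₂ j) (to T-≡ Eij)))
  unique-neighbour⇒deg≡1 {inj₂ j} {inj₁ _} uv only =
    length-filter-allFin≡1 (λ i → T? (E i j)) (from T-≡ uv)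
      (λ i Eij → inj₁-injective (only (inj₁ i) (to T-≡ Eij)))
  unique-neighbour⇒deg≡1 {inj₁ _} {inj₁ _} ()
  unique-neighbour⇒deg≡1 {inj₂ _} {inj₂ _} ()

  AdjacentOnlyTo⇒deg≡1 : NoIsolated G → ∀ u {v} → AdjacentOnlyTo u v → deg G u ≡ 1
  AdjacentOnlyTo⇒deg≡1 noIso u only with deg≢0⇒neighbour u (noIso u)
  ... | w , uw with refl ← only w uw = unique-neighbour⇒deg≡1 {u} uw only

  independent-cover⇒facet : NoIsolated G → ∀ {S} → Independent G S → VertexCover S → IsFacet G S
  independent-cover⇒facet noIso {S} indS coverS = indS , maximal
    where
    maximal : ∀ S′ → Independent G S′ → S ⊆ₛ S′ → S′ ⊆ₛ S
    maximal S′ indS′ S⊆S′ u u∈S′ with T? (S u)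
    ... | yes u∈S = u∈S
    ... | no  u∉S with deg≢0⇒neighbour u (noIso u)
    ...   | w , uw with coverS u w uw
    ...     | inj₁ u∈S = contradiction u∈S u∉S
    ...     | inj₂ w∈S = contradiction (S⊆S′ w w∈S) (adjacent⇒¬both-in-independent indS′ uw u∈S′)

  cover-resp-≐ : ∀ {S S′} → S ≐ S′ → VertexCover S → VertexCover S′
  cover-resp-≐ S≐S′ coverS u w uw with coverS u w uw
  ... | inj₁ u∈S = inj₁ (subst T (S≐S′ u) u∈S)
  ... | inj₂ w∈S = inj₂ (subst T (S≐S′ w) w∈S)

  cover∖facet≐singleton⇒AdjacentOnlyTo :
    ∀ {P Q v} → Independent G P → VertexCover P → IsFacet G Q →
    (∀ w → (w ∈ₛ P × ¬ w ∈ₛ Q) ⇔ (w ≡ v)) → ∃ λ u → AdjacentOnlyTo u v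
  cover∖facet≐singleton⇒AdjacentOnlyTo {P} {Q} {v} indP coverP (indQ , maximalQ) P∖Q≐｛v｝
    with vertex-any? (λ u → T? (Q u) ×-dec ¬? (T? (P u)))
  ... | yes (u , u∈Q , u∉P) = u , only
    where
    only : AdjacentOnlyTo u v
    only w uw with coverP u w uw
    ... | inj₁ u∈P = contradiction u∈P u∉P
    ... | inj₂ w∈P = to (P∖Q≐｛v｝ w) (w∈P , adjacent⇒¬both-in-independent indQ uw u∈Q)
  ... | no Q⊈P = contradiction (maximalQ P indP Q⊆P v (proj₁ v∈P∖Q)) (proj₂ v∈P∖Q)
    where
    Q⊆P : Q ⊆ₛ P
    Q⊆P u u∈Q with T? (P u)
    ... | yes u∈P = u∈P
    ... | no  u∉P = contradiction (u , u∈Q , u∉P) Q⊈P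
    v∈P∖Q : v ∈ₛ P × ¬ v ∈ₛ Q
    v∈P∖Q = from (P∖Q≐｛v｝ v) refl

  partX partY : VSet m n
  partX (inj₁ _) = true
  partX (inj₂ _) = false
  partY (inj₁ _) = false
  partY (inj₂ _) = true

  partX-independent : Independent G partX
  partX-independent (inj₁ _) (inj₁ _) _ _ = refl

  partY-independent : Independent G partY
  partY-independent (inj₂ _) (inj₂ _) _ _ = refl

  partX-cover : VertexCover partX
  partX-cover (inj₁ _) _        _ = inj₁ _
  partX-cover (inj₂ _) (inj₁ _) _ = inj₂ _

  partY-cover : VertexCover partY
  partY-cover (inj₂ _) _        _ = inj₁ _
  partY-cover (inj₁ _) (inj₂ _) _ = inj₂ _

  module _ (sh : Shelling G) where
    open Shelling sh

    later-cover⇒AdjacentOnlyTo : ∀ {i j} → i < j → VertexCover (F j) → ∃₂ AdjacentOnlyTo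
    later-cover⇒AdjacentOnlyTo {i} {j} i<j coverFj with shell i j i<j
    ... | v , _ , _ , ℓ , _ , Fj∖Fℓ≐｛v｝
      with cover∖facet≐singleton⇒AdjacentOnlyTo (proj₁ (facet j)) coverFj (facet ℓ) Fj∖Fℓ≐｛v｝
    ...   | u , only = u , v , only

    distinct-cover-facets⇒AdjacentOnlyTo :
      ∀ {S S′} → IsFacet G S → IsFacet G S′ → VertexCover S → VertexCover S′ → ¬ S ≐ S′ →
      ∃₂ AdjacentOnlyTo
    distinct-cover-facets⇒AdjacentOnlyTo {S} {S′} facetS facetS′ coverS coverS′ S≉S′
      with complete S facetS | complete S′ facetS′
    ... | i , Fi≐S | j , Fj≐S′ with <-cmp i j
    ...   | tri< i<j _ _ = later-cover⇒AdjacentOnlyTo i<j (cover-resp-≐ (sym ∘ Fj≐S′) coverS′)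
    ...   | tri> _ _ j<i = later-cover⇒AdjacentOnlyTo j<i (cover-resp-≐ (sym ∘ Fi≐S) coverS)
    ...   | tri≈ _ refl _ = contradiction (λ v → trans (sym (Fi≐S v)) (Fj≐S′ v)) S≉S′

lemma2p8 : (m n : ℕ) → m ≥ 1 → n ≥ 1 → (G : BipGraph m n) →
           Shellable G → NoIsolated G →
           Σ (Vertex m n) λ v → deg G v ≡ 1
lemma2p8 (suc m) n _ _ G sh noIso
  with distinct-cover-facets⇒AdjacentOnlyTo G sh
         (independent-cover⇒facet G noIso (partX-independent G) (partX-cover G))
         (independent-cover⇒facet G noIso (partY-independent G) (partY-cover G))
         (partX-cover G) (partY-cover G)
         (λ X≐Y → contradiction (X≐Y (inj₁ zero)) λ ())
... | u , _ , only = u , AdjacentOnlyTo⇒deg≡1 G noIso u only
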